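{- Let $u$ be a positive integer divisible by $4$. There exist a random 2-independent function $\mathit{Sample}:\{0,\ldots,u-1\}\to\{0,1\}$ and a function $v:\{0,\ldots,u-1\}\to\mathbb{R}$ with $v(x)\ne 0$ for at least one $x$, such that \[\Pr\Big[\sum\{v(x)\mid \mathit{Sample}(x)=1\}\neq 0\Big]\ \le\ 4/u.\]
   Context: A random function $h:U\to\{0,1\}$ is 2-independent if for any 2 distinct keys $x_1,x_2\in U$ and any $t_1,t_2\in\{0,1\}$, $\Pr[h(x_1)=t_1\wedge h(x_2)=t_2]=1/4$. -}

module Defs where

open import Data.Nat using (ℕ; zero; suc; _+_; _*_; _≤_; _<_)
open import Data.Bool using (Bool; true; false; if_then_else_; _∧_; not)
import Data.Bool as B
open import Data.Fin using (Fin)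
open import Data.List using (List; map; foldr; allFin)
open import Data.Rational using (ℚ; 0ℚ) renaming (_+_ to _+ℚ_)
import Data.Rational as Q
open import Relation.Nullary using (¬_)
open import Relation.Nullary.Decidable using (⌊_⌋)
open import Relation.Binary.PropositionalEquality using (_≡_; _≢_)

-- A random function  Sample : Fin u → Bool  is modelled by a finite
-- probability space: a uniformly random seed s ∈ Fin m (m > 0), and
-- a deterministic function  S : Fin m → Fin u → Bool.
-- Probabilities are counts: Pr[E] = count E / m.

count : (m : ℕ) → (Fin m → Bool) → ℕ
count m E = foldr _+_ 0 (map (λ s → if E s then 1 else 0) (allFin m))

-- 2-independence: for distinct x₁ x₂ and any t₁ t₂,
-- Pr[S(x₁)=t₁ ∧ S(x₂)=t₂] = 1/4, i.e. 4 * count = m.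
TwoIndependent : {m u : ℕ} → (Fin m → Fin u → Bool) → Set
TwoIndependent {m} {u} S =
  (x₁ x₂ : Fin u) → x₁ ≢ x₂ → (t₁ t₂ : Bool) →
  4 * count m (λ s → ⌊ S s x₁ B.≟ t₁ ⌋ ∧ ⌊ S s x₂ B.≟ t₂ ⌋) ≡ m

sampledSum : {m u : ℕ} → (Fin m → Fin u → Bool) → (Fin u → ℚ) → Fin m → ℚ
sampledSum {m} {u} S v s =
  foldr _+ℚ_ 0ℚ (map (λ x → if S s x then v x else 0ℚ) (allFin u))

sumNonzero : {m u : ℕ} → (Fin m → Fin u → Bool) → (Fin u → ℚ) → Fin m → Bool
sumNonzero S v s = not ⌊ sampledSum S v s Q.≟ 0ℚ ⌋

module Submission where

-- Identify a universe of size u = 2ᵈ + r (d ≥ 1, r ≤ 2ᵈ)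
-- injectively with points of the Boolean cube {0,1}ᵈ⁺¹, and let Sample be
-- the affine family  p ↦ c ⊕ ⟨ p , s ⟩  with a uniform seed (c , s).  It is
-- 2-independent: summing out the offset c reduces a pair event to the event
-- ⟨ p ⊕ q , s ⟩ = t for the nonzero vector p ⊕ q, and a nonzero linear
-- functional is balanced.  For v take the character (−1)^(last coordinate)
-- on the 2ᵈ points (0 , y) and 0 elsewhere; the sampled sum is then the sum
-- of this character over a half-space of {0,1}ᵈ, which vanishes unless the
-- half-space is cut out by the last unit vector.  So at most 4 of the 4 · 2ᵈ
-- seeds give a nonzero sum, a probability ≤ 1/2ᵈ < 2/u.

open import Algebra.Bundles using (CommutativeMonoid; CommutativeRing)
import Algebra.Properties.CommutativeSemigroup as CommutativeSemigroupProperties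
open import Data.Bool using (Bool; true; false; not; _∧_; _xor_; if_then_else_; _≟_)
open import Data.Bool.Properties using (∧-distribʳ-xor; xor-∧-commutativeRing; if-eta)
open import Data.Empty using (⊥-elim)
open import Data.Fin as Fin using (Fin; splitAt; join; _↑ˡ_; _↑ʳ_; inject≤)
open import Data.Fin.Properties using (join-splitAt; splitAt-↑ˡ; splitAt-↑ʳ; inject≤-injective)
open import Data.List using (foldr; map; allFin; tabulate)
open import Data.List.Properties using (map-tabulate)
open import Data.Nat as ℕ using (ℕ; zero; suc; _+_; _*_; _≤_; _<_; z≤n; s≤s)
import Data.Nat.Properties as ℕ
open import Data.Nat.Divisibility using (_∣_; ∣⇒≤)
open import Data.Product using (Σ; ∃; _×_; _,_; proj₁; proj₂)
open import Data.Rational as ℚ using (ℚ; 0ℚ; 1ℚ)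
import Data.Rational.Properties as ℚ
open import Data.Sum using (_⊎_; inj₁; inj₂; [_,_]′)
open import Data.Vec using (Vec; []; _∷_; zipWith; replicate; tail)
open import Data.Vec.Properties using (∷-injective)
open import Function using (_∘_; id)
open import Function.Definitions using (Injective)
open import Relation.Nullary.Decidable using (⌊_⌋)
open import Relation.Binary.PropositionalEquality as ≡
  using (_≡_; _≢_; refl; cong; cong₂; module ≡-Reasoning)

open import Defs

-- The Boolean cube {0,1}ᴰ has 2ᴰ points; we write the size recursively
-- so that Fin (cubeSize (suc D)) splits as two copies of Fin (cubeSize D).
cubeSize : ℕ → ℕ
cubeSize zero    = 1
cubeSize (suc D) = cubeSize D + cubeSize D

tag : ∀ {a b} {A : Set a} {B : Set b} {n} →
      (A → Vec Bool n) → (B → Vec Bool n) → A ⊎ B → Vec Bool (suc n)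
tag f g (inj₁ x) = false ∷ f x
tag f g (inj₂ y) = true ∷ g y

tag-injective : ∀ {a b} {A : Set a} {B : Set b} {n}
  {f : A → Vec Bool n} {g : B → Vec Bool n} →
  Injective _≡_ _≡_ f → Injective _≡_ _≡_ g → Injective _≡_ _≡_ (tag f g)
tag-injective f-inj g-inj {inj₁ x} {inj₁ x′} eq = cong inj₁ (f-inj (proj₂ (∷-injective eq)))
tag-injective f-inj g-inj {inj₂ y} {inj₂ y′} eq = cong inj₂ (g-inj (proj₂ (∷-injective eq)))
tag-injective f-inj g-inj {inj₁ x} {inj₂ y} ()
tag-injective f-inj g-inj {inj₂ y} {inj₁ x} ()

splitAt-injective : ∀ m {n} → Injective _≡_ _≡_ (splitAt m {n})
splitAt-injective m {n} {i} {j} eq = begin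
  i                      ≡⟨ join-splitAt m n i ⟨
  join m n (splitAt m i) ≡⟨ cong (join m n) eq ⟩
  join m n (splitAt m j) ≡⟨ join-splitAt m n j ⟩
  j                      ∎
  where open ≡-Reasoning

decode : ∀ D → Fin (cubeSize D) → Vec Bool D
decode zero    _ = []
decode (suc D) i = tag (decode D) (decode D) (splitAt (cubeSize D) i)

decode-injective : ∀ D → Injective _≡_ _≡_ (decode D)
decode-injective zero    {Fin.zero} {Fin.zero} _ = refl
decode-injective (suc D) eq =
  splitAt-injective (cubeSize D)
    (tag-injective (decode-injective D) (decode-injective D) eq)

module CubeSums {c ℓ} (M : CommutativeMonoid c ℓ) where

  open CommutativeMonoid M renaming (refl to ≈-refl; sym to ≈-sym; trans to ≈-trans)
  open CommutativeSemigroupProperties commutativeSemigroup using (interchange)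
  open import Algebra.Properties.Monoid.Sum monoid public using (sum; sum-cong-≗; sum-replicate-zero)
  open import Relation.Binary.Reasoning.Setoid setoid

  listSum-allFin : ∀ n (f : Fin n → Carrier) → foldr _∙_ ε (map f (allFin n)) ≡ sum f
  listSum-allFin n f = ≡.trans (cong (foldr _∙_ ε) (map-tabulate id f)) (listSum-tabulate n f)
    where
    listSum-tabulate : ∀ n (g : Fin n → Carrier) → foldr _∙_ ε (tabulate g) ≡ sum g
    listSum-tabulate zero    g = refl
    listSum-tabulate (suc n) g = cong (g Fin.zero ∙_) (listSum-tabulate n (g ∘ Fin.suc))

  sum-split : ∀ m n (f : Fin (m + n) → Carrier) →
    sum f ≈ sum (f ∘ (_↑ˡ n)) ∙ sum (f ∘ (m ↑ʳ_))
  sum-split zero    n f = ≈-sym (identityˡ _)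
  sum-split (suc m) n f = begin
    f Fin.zero ∙ sum (f ∘ Fin.suc)                                       ≈⟨ ∙-congˡ (sum-split m n (f ∘ Fin.suc)) ⟩
    f Fin.zero ∙ (sum (f ∘ Fin.suc ∘ (_↑ˡ n)) ∙ sum (f ∘ (suc m ↑ʳ_)))  ≈⟨ assoc _ _ _ ⟨
    sum (f ∘ (_↑ˡ n)) ∙ sum (f ∘ (suc m ↑ʳ_))                            ∎

  cubeSum : ∀ D → (Vec Bool D → Carrier) → Carrier
  cubeSum zero    f = f []
  cubeSum (suc D) f = cubeSum D (f ∘ (false ∷_)) ∙ cubeSum D (f ∘ (true ∷_))

  cubeSum-cong : ∀ D {f g : Vec Bool D → Carrier} → (∀ x → f x ≈ g x) → cubeSum D f ≈ cubeSum D g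
  cubeSum-cong zero    f≈g = f≈g []
  cubeSum-cong (suc D) f≈g = ∙-cong (cubeSum-cong D (f≈g ∘ (false ∷_))) (cubeSum-cong D (f≈g ∘ (true ∷_)))

  cubeSum-distrib : ∀ D (f g : Vec Bool D → Carrier) →
    cubeSum D (λ x → f x ∙ g x) ≈ cubeSum D f ∙ cubeSum D g
  cubeSum-distrib zero    f g = ≈-refl
  cubeSum-distrib (suc D) f g = begin
    cubeSum D (λ x → f (false ∷ x) ∙ g (false ∷ x)) ∙ cubeSum D (λ x → f (true ∷ x) ∙ g (true ∷ x))
      ≈⟨ ∙-cong (cubeSum-distrib D _ _) (cubeSum-distrib D _ _) ⟩
    (cubeSum D (f ∘ (false ∷_)) ∙ cubeSum D (g ∘ (false ∷_))) ∙ (cubeSum D (f ∘ (true ∷_)) ∙ cubeSum D (g ∘ (true ∷_)))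
      ≈⟨ interchange _ _ _ _ ⟩
    cubeSum (suc D) f ∙ cubeSum (suc D) g ∎

  cubeSum-ε : ∀ D → cubeSum D (λ _ → ε) ≈ ε
  cubeSum-ε zero    = ≈-refl
  cubeSum-ε (suc D) = ≈-trans (∙-cong (cubeSum-ε D) (cubeSum-ε D)) (identityˡ ε)

  sum-decode : ∀ D (f : Vec Bool D → Carrier) → sum (f ∘ decode D) ≈ cubeSum D f
  sum-decode zero    f = identityʳ (f [])
  sum-decode (suc D) f = begin
    sum (f ∘ decode (suc D))
      ≈⟨ sum-split (cubeSize D) (cubeSize D) _ ⟩
    sum (f ∘ decode (suc D) ∘ (_↑ˡ cubeSize D)) ∙ sum (f ∘ decode (suc D) ∘ (cubeSize D ↑ʳ_))
      ≡⟨ cong₂ _∙_ (sum-cong-≗ left) (sum-cong-≗ right) ⟩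
    sum (f ∘ (false ∷_) ∘ decode D) ∙ sum (f ∘ (true ∷_) ∘ decode D)
      ≈⟨ ∙-cong (sum-decode D _) (sum-decode D _) ⟩
    cubeSum (suc D) f ∎
    where
    left : ∀ i → f (decode (suc D) (i ↑ˡ cubeSize D)) ≡ f (false ∷ decode D i)
    left i = cong (f ∘ tag (decode D) (decode D)) (splitAt-↑ˡ (cubeSize D) i (cubeSize D))
    right : ∀ i → f (decode (suc D) (cubeSize D ↑ʳ i)) ≡ f (true ∷ decode D i)
    right i = cong (f ∘ tag (decode D) (decode D)) (splitAt-↑ʳ (cubeSize D) (cubeSize D) i)

⟨_,_⟩ : ∀ {n} → Vec Bool n → Vec Bool n → Bool
⟨ []    , []    ⟩ = false
⟨ x ∷ p , s ∷ q ⟩ = (x ∧ s) xor ⟨ p , q ⟩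

_⊕_ : ∀ {n} → Vec Bool n → Vec Bool n → Vec Bool n
_⊕_ = zipWith _xor_

open CommutativeSemigroupProperties (CommutativeRing.+-commutativeSemigroup xor-∧-commutativeRing)
  using () renaming (interchange to xor-interchange)

inner-⊕ : ∀ {n} (p q s : Vec Bool n) → ⟨ p , s ⟩ xor ⟨ q , s ⟩ ≡ ⟨ p ⊕ q , s ⟩
inner-⊕ []      []      []      = refl
inner-⊕ (a ∷ p) (b ∷ q) (x ∷ s) = begin
  ((a ∧ x) xor ⟨ p , s ⟩) xor ((b ∧ x) xor ⟨ q , s ⟩)  ≡⟨ xor-interchange (a ∧ x) _ _ _ ⟩
  ((a ∧ x) xor (b ∧ x)) xor (⟨ p , s ⟩ xor ⟨ q , s ⟩)  ≡⟨ cong₂ _xor_ (≡.sym (∧-distribʳ-xor x a b)) (inner-⊕ p q s) ⟩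
  ((a xor b) ∧ x) xor ⟨ p ⊕ q , s ⟩                    ∎
  where open ≡-Reasoning

xor≡false : ∀ {a b} → a xor b ≡ false → a ≡ b
xor≡false {false} {false} _ = refl
xor≡false {true}  {true}  _ = refl

⊕-zero⇒≡ : ∀ {n} (p q : Vec Bool n) → p ⊕ q ≡ replicate n false → p ≡ q
⊕-zero⇒≡ []      []      _  = refl
⊕-zero⇒≡ (a ∷ p) (b ∷ q) eq = cong₂ _∷_ (xor≡false (proj₁ (∷-injective eq))) (⊕-zero⇒≡ p q (proj₂ (∷-injective eq)))

module ℕSum = CubeSums ℕ.+-0-commutativeMonoid

indicator : Bool → ℕ
indicator b = if b then 1 else 0

card : ∀ D → (Vec Bool D → Bool) → ℕ
card D E = ℕSum.cubeSum D (indicator ∘ E)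

count-decode : ∀ D (E : Vec Bool D → Bool) → count (cubeSize D) (E ∘ decode D) ≡ card D E
count-decode D E = ≡.trans (ℕSum.listSum-allFin _ (indicator ∘ E ∘ decode D)) (ℕSum.sum-decode D (indicator ∘ E))

card-all : ∀ D → ℕSum.cubeSum D (λ _ → 1) ≡ cubeSize D
card-all zero    = refl
card-all (suc D) = cong₂ _+_ (card-all D) (card-all D)

card-mono : ∀ D {E E′ : Vec Bool D → Bool} → (∀ s → E s ≡ true → E′ s ≡ true) → card D E ≤ card D E′
card-mono zero    {E} E⇒E′ with E [] | E⇒E′ []
... | true  | E′-holds = ℕ.≤-reflexive (cong indicator (≡.sym (E′-holds refl)))
... | false | _        = z≤n
card-mono (suc D) E⇒E′ = ℕ.+-mono-≤ (card-mono D (E⇒E′ ∘ (false ∷_))) (card-mono D (E⇒E′ ∘ (true ∷_)))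

exactlyOne-of-two : ∀ b t → indicator ⌊ b ≟ t ⌋ + indicator ⌊ not b ≟ t ⌋ ≡ 1
exactlyOne-of-two false false = refl
exactlyOne-of-two false true  = refl
exactlyOne-of-two true  false = refl
exactlyOne-of-two true  true  = refl

balanced : ∀ D (r : Vec Bool D) → r ≢ replicate D false → ∀ t →
  2 * card D (λ s → ⌊ ⟨ r , s ⟩ ≟ t ⌋) ≡ cubeSize D
balanced zero    []        r≢0 t = ⊥-elim (r≢0 refl)
balanced (suc D) (false ∷ r) r≢0 t = begin
  2 * (card D E + card D E)            ≡⟨ ℕ.*-distribˡ-+ 2 (card D E) (card D E) ⟩
  2 * card D E + 2 * card D E          ≡⟨ cong₂ _+_ half half ⟩
  cubeSize D + cubeSize D              ∎
  where
  open ≡-Reasoning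
  E : Vec Bool D → Bool
  E s = ⌊ ⟨ r , s ⟩ ≟ t ⌋
  half : 2 * card D E ≡ cubeSize D
  half = balanced D r (r≢0 ∘ cong (false ∷_)) t
balanced (suc D) (true ∷ r) r≢0 t = begin
  2 * (card D E + card D E′)           ≡⟨ cong (2 *_) split ⟩
  2 * cubeSize D                       ≡⟨ cong (cubeSize D +_) (ℕ.+-identityʳ (cubeSize D)) ⟩
  cubeSize D + cubeSize D              ∎
  where
  open ≡-Reasoning
  E E′ : Vec Bool D → Bool
  E  s = ⌊ ⟨ r , s ⟩ ≟ t ⌋
  E′ s = ⌊ not ⟨ r , s ⟩ ≟ t ⌋
  split : card D E + card D E′ ≡ cubeSize D
  split = begin
    card D E + card D E′                                             ≡⟨ ℕSum.cubeSum-distrib D _ _ ⟨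
    ℕSum.cubeSum D (λ s → indicator (E s) + indicator (E′ s))        ≡⟨ ℕSum.cubeSum-cong D (λ s → exactlyOne-of-two ⟨ r , s ⟩ t) ⟩
    ℕSum.cubeSum D (λ _ → 1)                                         ≡⟨ card-all D ⟩
    cubeSize D                                                       ∎

sample : ∀ {n} → Vec Bool (suc n) → Vec Bool n → Bool
sample (c ∷ s) p = c xor ⟨ p , s ⟩

-- Summing over the offset c: the two values c ⊕ a, c ⊕ b hit (t₁ , t₂) for
-- exactly one c when a ⊕ b = t₁ ⊕ t₂, and for none otherwise.
offset-count : ∀ a b t₁ t₂ →
  indicator (⌊ a ≟ t₁ ⌋ ∧ ⌊ b ≟ t₂ ⌋) + indicator (⌊ not a ≟ t₁ ⌋ ∧ ⌊ not b ≟ t₂ ⌋)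
    ≡ indicator ⌊ a xor b ≟ t₁ xor t₂ ⌋
offset-count false false false false = refl
offset-count false false false true  = refl
offset-count false false true  false = refl
offset-count false false true  true  = refl
offset-count false true  false false = refl
offset-count false true  false true  = refl
offset-count false true  true  false = refl
offset-count false true  true  true  = refl
offset-count true  false false false = refl
offset-count true  false false true  = refl
offset-count true  false true  false = refl
offset-count true  false true  true  = refl
offset-count true  true  false false = refl
offset-count true  true  false true  = refl
offset-count true  true  true  false = refl
offset-count true  true  true  true  = refl

-- The affine family on any injectively embedded domain is 2-independent:
-- after summing out the offset, the pair event becomes ⟨ p ⊕ q , s ⟩ = t₁ ⊕ t₂,
-- a nonzero linear functional taking a fixed value, which is balanced.
affine-twoIndependent : ∀ {u} n (pt : Fin u → Vec Bool n) → Injective _≡_ _≡_ pt →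
  TwoIndependent (λ seed x → sample (decode (suc n) seed) (pt x))
affine-twoIndependent n pt pt-inj x₁ x₂ x₁≢x₂ t₁ t₂ = begin
  4 * count (cubeSize (suc n)) (E ∘ decode (suc n))  ≡⟨ cong (4 *_) (count-decode (suc n) E) ⟩
  4 * card (suc n) E                                 ≡⟨ cong (4 *_) sum-out-offset ⟩
  4 * card n F                                       ≡⟨ ℕ.*-assoc 2 2 (card n F) ⟩
  2 * (2 * card n F)                                 ≡⟨ cong (2 *_) (balanced n (p ⊕ q) p⊕q≢0 (t₁ xor t₂)) ⟩
  2 * cubeSize n                                     ≡⟨ cong (cubeSize n +_) (ℕ.+-identityʳ (cubeSize n)) ⟩
  cubeSize n + cubeSize n                            ∎
  where
  open ≡-Reasoning
  p q : Vec Bool n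
  p = pt x₁
  q = pt x₂
  E : Vec Bool (suc n) → Bool
  E seed = ⌊ sample seed p ≟ t₁ ⌋ ∧ ⌊ sample seed q ≟ t₂ ⌋
  F : Vec Bool n → Bool
  F s = ⌊ ⟨ p ⊕ q , s ⟩ ≟ t₁ xor t₂ ⌋
  sum-out-offset : card (suc n) E ≡ card n F
  sum-out-offset = begin
    card n (E ∘ (false ∷_)) + card n (E ∘ (true ∷_))                        ≡⟨ ℕSum.cubeSum-distrib n _ _ ⟨
    ℕSum.cubeSum n (λ s → indicator (E (false ∷ s)) + indicator (E (true ∷ s)))
      ≡⟨ ℕSum.cubeSum-cong n (λ s → ≡.trans (offset-count ⟨ p , s ⟩ ⟨ q , s ⟩ t₁ t₂)
                                         (cong (λ b → indicator ⌊ b ≟ t₁ xor t₂ ⌋) (inner-⊕ p q s))) ⟩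
    card n F                                                                ∎
  p⊕q≢0 : p ⊕ q ≢ replicate n false
  p⊕q≢0 = x₁≢x₂ ∘ pt-inj ∘ ⊕-zero⇒≡ p q

module ℚSum = CubeSums ℚ.+-0-commutativeMonoid

sign : ∀ {e} → Vec Bool (suc e) → ℚ
sign {zero}  (b ∷ []) = if b then ℚ.- 1ℚ else 1ℚ
sign {suc e} (_ ∷ x)  = sign x

sign-nonzero : ∀ {e} (x : Vec Bool (suc e)) → sign x ≢ 0ℚ
sign-nonzero {zero}  (true  ∷ []) ()
sign-nonzero {zero}  (false ∷ []) ()
sign-nonzero {suc e} (_ ∷ x)      = sign-nonzero x

sign-sum : ∀ e → ℚSum.cubeSum (suc e) sign ≡ 0ℚ
sign-sum zero    = refl
sign-sum (suc e) = cong₂ ℚ._+_ (sign-sum e) (sign-sum e)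

isLastUnit : ∀ {e} → Vec Bool (suc e) → Bool
isLastUnit {zero}  (b ∷ []) = b
isLastUnit {suc e} (b ∷ s)  = not b ∧ isLastUnit s

card-isLastUnit : ∀ e → card (suc e) isLastUnit ≡ 1
card-isLastUnit zero    = refl
card-isLastUnit (suc e) = cong₂ _+_ (card-isLastUnit e) (ℕSum.cubeSum-ε (suc e))

halfSpaceSign : ∀ {e} → Bool → Vec Bool (suc e) → ℚ
halfSpaceSign {e} c s = ℚSum.cubeSum (suc e) (λ x → if c xor ⟨ x , s ⟩ then sign x else 0ℚ)

complementary : ∀ c b q → (if c xor b then q else 0ℚ) ℚ.+ (if c xor not b then q else 0ℚ) ≡ q
complementary false false q = ℚ.+-identityˡ q
complementary false true  q = ℚ.+-identityʳ q
complementary true  false q = ℚ.+-identityʳ q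
complementary true  true  q = ℚ.+-identityˡ q

-- Induction on the first coordinate of s:
-- if it is 1, the two halves of the cube see complementary half-spaces and
-- add up to the full sum of sign; if it is 0, both halves see the same one.
halfSpaceSign-vanishes : ∀ {e} c (s : Vec Bool (suc e)) → isLastUnit s ≡ false → halfSpaceSign c s ≡ 0ℚ
halfSpaceSign-vanishes {zero}  false (false ∷ []) _ = refl
halfSpaceSign-vanishes {zero}  true  (false ∷ []) _ = refl
halfSpaceSign-vanishes {suc e} c     (false ∷ s)  s≢unit =
  cong₂ ℚ._+_ (halfSpaceSign-vanishes c s s≢unit) (halfSpaceSign-vanishes c s s≢unit)
halfSpaceSign-vanishes {suc e} c     (true ∷ s)   _ = begin
  ℚSum.cubeSum (suc e) inside ℚ.+ ℚSum.cubeSum (suc e) outside  ≡⟨ ℚSum.cubeSum-distrib (suc e) inside outside ⟨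
  ℚSum.cubeSum (suc e) (λ x → inside x ℚ.+ outside x)          ≡⟨ ℚSum.cubeSum-cong (suc e) (λ x → complementary c ⟨ x , s ⟩ (sign x)) ⟩
  ℚSum.cubeSum (suc e) sign                                    ≡⟨ sign-sum e ⟩
  0ℚ                                                           ∎
  where
  open ≡-Reasoning
  inside outside : Vec Bool (suc e) → ℚ
  inside  x = if c xor ⟨ x , s ⟩ then sign x else 0ℚ
  outside x = if c xor not ⟨ x , s ⟩ then sign x else 0ℚ

cubeSize-positive : ∀ D → 0 < cubeSize D
cubeSize-positive zero    = s≤s z≤n
cubeSize-positive (suc D) = ℕ.<-≤-trans (cubeSize-positive D) (ℕ.m≤m+n _ _)

SparseCancellation : ℕ → Set
SparseCancellation u =
  Σ ℕ λ m → 0 < m ×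
    Σ (Fin m → Fin u → Bool) λ S → TwoIndependent S ×
      Σ (Fin u → ℚ) λ v → (∃ λ x → v x ≢ 0ℚ) ×
        u * count m (sumNonzero S v) ≤ 4 * m

-- Points are embedded injectively into {0,1}ᵈ⁺¹: the first 2ᵈ
-- points as (0 , y) for y ∈ {0,1}ᵈ, the other r as (1 , y).  The sampled sum is then a half-space sum of sign,
-- which is nonzero only for the 4 seeds (c , b , s) with s the last unit
-- vector, out of 4 · 2ᵈ seeds.
module Construction (e r : ℕ) (r≤2ᵈ : r ≤ cubeSize (suc e)) where

  d : ℕ
  d = suc e

  u : ℕ
  u = cubeSize d + r

  embed : Fin u → Vec Bool (suc d)
  embed = tag (decode d) (decode d ∘ λ z → inject≤ z r≤2ᵈ) ∘ splitAt (cubeSize d)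

  embed-injective : Injective _≡_ _≡_ embed
  embed-injective = splitAt-injective (cubeSize d)
    ∘ tag-injective (decode-injective d) (inject≤-injective r≤2ᵈ r≤2ᵈ _ _ ∘ decode-injective d)

  v : Fin u → ℚ
  v = [ sign ∘ decode d , (λ _ → 0ℚ) ]′ ∘ splitAt (cubeSize d)

  seeds : ℕ
  seeds = cubeSize (suc (suc d))

  Sample : Fin seeds → Fin u → Bool
  Sample seed x = sample (decode (suc (suc d)) seed) (embed x)

  sampledSum′ : Vec Bool (suc (suc d)) → ℚ
  sampledSum′ seed = foldr ℚ._+_ 0ℚ (map (λ x → if sample seed (embed x) then v x else 0ℚ) (allFin u))

  -- Only the points (0 , y) contribute, and there the seed (c , b , s)
  -- samples exactly the half-space c ⊕ ⟨ y , s ⟩ = 1.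
  sampledSum-halfSpace : ∀ c b s → sampledSum′ (c ∷ b ∷ s) ≡ halfSpaceSign c s
  sampledSum-halfSpace c b s = begin
    sampledSum′ (c ∷ b ∷ s)                              ≡⟨ ℚSum.listSum-allFin u term ⟩
    sum term                                             ≡⟨ ℚSum.sum-split (cubeSize d) r term ⟩
    sum (term ∘ (_↑ˡ r)) ℚ.+ sum (term ∘ (cubeSize d ↑ʳ_))
      ≡⟨ cong₂ ℚ._+_ (sum-cong-≗ first-block) (sum-cong-≗ second-block) ⟩
    sum (halfSpaceTerm ∘ decode d) ℚ.+ sum {r} (λ _ → 0ℚ)
      ≡⟨ cong₂ ℚ._+_ (ℚSum.sum-decode d halfSpaceTerm) (sum-replicate-zero r) ⟩
    halfSpaceSign c s ℚ.+ 0ℚ                             ≡⟨ ℚ.+-identityʳ _ ⟩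
    halfSpaceSign c s                                    ∎
    where
    open ≡-Reasoning
    open ℚSum using (sum; sum-cong-≗; sum-replicate-zero)
    term : Fin u → ℚ
    term x = if sample (c ∷ b ∷ s) (embed x) then v x else 0ℚ
    halfSpaceTerm : Vec Bool d → ℚ
    halfSpaceTerm y = if c xor ⟨ y , s ⟩ then sign y else 0ℚ
    first-block : ∀ i → term (i ↑ˡ r) ≡ halfSpaceTerm (decode d i)
    first-block i rewrite splitAt-↑ˡ (cubeSize d) i r = refl
    second-block : ∀ i → term (cubeSize d ↑ʳ i) ≡ 0ℚ
    second-block i rewrite splitAt-↑ʳ (cubeSize d) r i = if-eta _

  nonzero⇒lastUnit : ∀ seed → not ⌊ sampledSum′ seed ℚ.≟ 0ℚ ⌋ ≡ true →
                     isLastUnit (tail (tail seed)) ≡ true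
  nonzero⇒lastUnit (c ∷ b ∷ s) nonzero with isLastUnit s in s-unit
  ... | true  = refl
  ... | false with ≡.subst (λ q → not ⌊ q ℚ.≟ 0ℚ ⌋ ≡ true) sum≡0 nonzero
    where
    sum≡0 : sampledSum′ (c ∷ b ∷ s) ≡ 0ℚ
    sum≡0 = ≡.trans (sampledSum-halfSpace c b s) (halfSpaceSign-vanishes c s s-unit)
  ...   | ()

  nonzero-count : count seeds (sumNonzero Sample v) ≤ 4
  nonzero-count = begin
    count seeds (sumNonzero Sample v)                   ≡⟨ count-decode (suc (suc d)) (λ seed → not ⌊ sampledSum′ seed ℚ.≟ 0ℚ ⌋) ⟩
    card (suc (suc d)) (λ seed → not ⌊ sampledSum′ seed ℚ.≟ 0ℚ ⌋)
                                                        ≤⟨ card-mono (suc (suc d)) nonzero⇒lastUnit ⟩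
    card (suc (suc d)) (isLastUnit ∘ tail ∘ tail)       ≡⟨ cong (λ k → (k + k) + (k + k)) (card-isLastUnit e) ⟩
    4                                                   ∎
    where open ℕ.≤-Reasoning

  -- u ≤ 2 · 2ᵈ and at most 4 of the 4 · 2ᵈ seeds are bad.
  probability-bound : u * count seeds (sumNonzero Sample v) ≤ 4 * seeds
  probability-bound = begin
    u * count seeds (sumNonzero Sample v)   ≤⟨ ℕ.*-mono-≤ (ℕ.+-monoʳ-≤ (cubeSize d) r≤2ᵈ) nonzero-count ⟩
    cubeSize (suc d) * 4                    ≡⟨ ℕ.*-comm (cubeSize (suc d)) 4 ⟩
    4 * cubeSize (suc d)                    ≤⟨ ℕ.*-monoʳ-≤ 4 (ℕ.m≤m+n (cubeSize (suc d)) (cubeSize (suc d))) ⟩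
    4 * seeds                               ∎
    where open ℕ.≤-Reasoning

  sparseCancellation : SparseCancellation u
  sparseCancellation =
    seeds , cubeSize-positive (suc (suc d)) ,
    Sample , affine-twoIndependent (suc d) embed embed-injective ,
    v , (someIndex ↑ˡ r , v-nonzero) , probability-bound
    where
    someIndex : Fin (cubeSize d)
    someIndex = Fin.fromℕ< (cubeSize-positive d)
    v-nonzero : v (someIndex ↑ˡ r) ≢ 0ℚ
    v-nonzero rewrite splitAt-↑ˡ (cubeSize d) someIndex r = sign-nonzero (decode d someIndex)

dyadic-decomposition : ∀ k → Σ ℕ λ e → Σ ℕ λ r → 2 + k ≡ cubeSize (suc e) + r × r ≤ cubeSize (suc e)
dyadic-decomposition zero = 0 , 0 , refl , z≤n
dyadic-decomposition (suc k) with dyadic-decomposition k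
... | e , r , eq , r≤ with ℕ.m≤n⇒m<n∨m≡n r≤
...   | inj₁ r<  = e , suc r , ≡.trans (cong suc eq) (≡.sym (ℕ.+-suc _ r)) , r<
...   | inj₂ refl = suc e , 1 , ≡.trans (cong suc eq) (ℕ.+-comm 1 _) , cubeSize-positive (suc (suc e))

proposition13 : (u : ℕ) → 0 < u → 4 ∣ u →
    Σ ℕ λ m → 0 < m ×
      Σ (Fin m → Fin u → Bool) λ S → TwoIndependent S ×
        Σ (Fin u → ℚ) λ v → (∃ λ x → v x ≢ 0ℚ) ×
          u * count m (sumNonzero S v) ≤ 4 * m
proposition13 zero          ()
proposition13 (suc zero)    _ 4∣1 with ∣⇒≤ 4∣1
... | s≤s ()
proposition13 (suc (suc k)) _ _ with dyadic-decomposition k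
... | e , r , u≡ , r≤ = ≡.subst SparseCancellation (≡.sym u≡) (Construction.sparseCancellation e r r≤)
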